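{- Let $n\ge1$. If there exist sets $\mathcal{B}^{(0)},\mathcal{B}^{(1)},\mathcal{B}^{(2)}$ of square-free words of length $n$ over $\{0,1,2\}$ with $|\mathcal{B}^{(0)}|=2$, $|\mathcal{B}^{(1)}|=|\mathcal{B}^{(2)}|=1$, all four words pairwise distinct, such that for every square-free word $ii'i''$ of length $3$ over $\{0,1,2\}$ and all $w\in\mathcal{B}^{(i)}$, $w'\in\mathcal{B}^{(i')}$, $w''\in\mathcal{B}^{(i'')}$ the word $ww'w''$ is square-free (an $n$-Brinkhuis $(2,1,1)$-triple), then $n>17$.
   Context: A word is square-free if it cannot be written as $xyyz$ with words $x,y,z$ and $y$ nonempty. -}

module Defs where

open import Data.Nat using (ℕ)
open import Data.Fin using (Fin; zero; suc)
open import Data.List using (List; []; _∷_; _++_; length)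
open import Data.List.Membership.Propositional using (_∈_)
open import Data.Product using (∃-syntax; _×_)
open import Relation.Binary.PropositionalEquality using (_≡_; _≢_)
open import Relation.Nullary using (¬_)

Letter : Set
Letter = Fin 3

Word : Set
Word = List Letter

SquareFree : Word → Set
SquareFree w = ¬ (∃[ x ] ∃[ y ] ∃[ z ] (y ≢ [] × w ≡ x ++ y ++ y ++ z))

blocks : Word → Word → Word → Word → Letter → List Word
blocks a b c d zero = a ∷ b ∷ []
blocks a b c d (suc zero) = c ∷ []
blocks a b c d (suc (suc zero)) = d ∷ []

record Brinkhuis211 (n : ℕ) (a b c d : Word) : Set where
  field
    len-a : length a ≡ n
    len-b : length b ≡ n
    len-c : length c ≡ n
    len-d : length d ≡ n
    sf-a : SquareFree a
    sf-b : SquareFree b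
    sf-c : SquareFree c
    sf-d : SquareFree d
    a≢b : a ≢ b
    a≢c : a ≢ c
    a≢d : a ≢ d
    b≢c : b ≢ c
    b≢d : b ≢ d
    c≢d : c ≢ d
    concat-sf : ∀ (i i′ i″ : Letter) → SquareFree (i ∷ i′ ∷ i″ ∷ []) →
                ∀ w w′ w″ → w ∈ blocks a b c d i → w′ ∈ blocks a b c d i′ →
                w″ ∈ blocks a b c d i″ → SquareFree (w ++ w′ ++ w″)

{-# OPTIONS --safe #-}
-- Permuting the alphabet preserves Brinkhuis triples, so we may assume that c begins with 01.
-- Since factors of square-free words are square-free, the four words must then pass a chain of
-- necessary conditions: d c d and c d c are square-free; a and b each survive the tests
-- a c a, a d a, c a c, d a d and all products over ({a}, {c}, {d}); finally the pair a ≠ b passes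
-- all products over ({a, b}, {c}, {d}). For n ≤ 17, an exhaustive search of the words that pass
-- these conditions (built letter by letter and checked by evaluation) comes back empty.
module Submission where

open import Defs
open import Data.Bool using (Bool; true; false; T; not; _∧_; _∨_)
open import Data.Bool.Properties using (T-∧; T-∨)
open import Data.Empty using (⊥-elim)
open import Data.Fin using (Fin; zero; suc)
open import Data.Fin.Patterns using (0F; 1F; 2F)
open import Data.Fin.Permutation using (Permutation′; _⟨$⟩ʳ_; _⟨$⟩ˡ_; inverseˡ; transpose; _∘ₚ_; id)
open import Data.Fin.Properties using (_≟_)
open import Data.List
  using (List; []; _∷_; [_]; _++_; length; map; concatMap; filter; allFin; cartesianProduct)
open import Data.List.Properties
  using (++-assoc; ++-identityʳ; ++-conicalʳ; ∷-injectiveʳ; map-++; length-map; length-++; ≡-dec)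
open import Data.List.Membership.Propositional using (_∈_; lose)
open import Data.List.Membership.Propositional.Properties
  using (∈-map⁺; ∈-map⁻; ∈-concatMap⁺; ∈-filter⁺; ∈-filter⁻; ∈-allFin)
open import Data.List.Relation.Binary.Subset.Propositional using (_⊆_)
open import Data.List.Relation.Unary.All as All using (All; []; _∷_)
open import Data.List.Relation.Unary.All.Properties using (applyUpTo⁻)
open import Data.List.Relation.Unary.Any using (here; there)
open import Data.List.Relation.Unary.Any.Properties using (¬Any[])
open import Data.Nat using (ℕ; zero; suc; _+_; _≤_; _<_; _>_; s≤s)
open import Data.Nat.Properties using (_<?_; ≮⇒≥; +-comm)
open import Data.Product using (_×_; _,_; proj₂; ∃-syntax)
open import Data.Sum using ([_,_]′)
open import Function using (_∘_; Equivalence)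
open import Relation.Binary.PropositionalEquality
  using (_≡_; _≢_; refl; sym; trans; cong; cong₂; subst; module ≡-Reasoning)
open import Relation.Nullary using (¬_; Dec; yes; no; ¬?; _×-dec_; T?)

SquarePrefix : Word → Set
SquarePrefix w = ∃[ y ] ∃[ z ] (y ≢ [] × w ≡ y ++ y ++ z)

squarePrefix⇒¬squareFree : ∀ {w} → SquarePrefix w → ¬ SquareFree w
squarePrefix⇒¬squareFree (y , z , y≢[] , eq) sf = sf ([] , y , z , y≢[] , eq)

squareFree-∷⁺ : ∀ {x w} → SquareFree w → ¬ SquarePrefix (x ∷ w) → SquareFree (x ∷ w)
squareFree-∷⁺ sf ¬sq ([]    , y , z , y≢[] , eq) = ¬sq (y , z , y≢[] , eq)
squareFree-∷⁺ sf ¬sq (_ ∷ x , y , z , y≢[] , eq) = sf (x , y , z , y≢[] , ∷-injectiveʳ eq)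

squareFree-∷∷⁻ : ∀ {x y w} → SquareFree (x ∷ y ∷ w) → x ≢ y
squareFree-∷∷⁻ {x} {w = w} sf refl = sf ([] , [ x ] , w , (λ ()) , refl)

squareFree-++⁻ʳ : ∀ u {v} → SquareFree (u ++ v) → SquareFree v
squareFree-++⁻ʳ u sf (x , y , z , y≢[] , eq) =
  sf (u ++ x , y , z , y≢[] , trans (cong (u ++_) eq) (sym (++-assoc u x _)))

squareFree-++⁻ˡ : ∀ u {v} → SquareFree (u ++ v) → SquareFree u
squareFree-++⁻ˡ u {v} sf (x , y , z , y≢[] , eq) = sf (x , y , z ++ v , y≢[] , u++v≡)
  where
  open ≡-Reasoning
  u++v≡ : u ++ v ≡ x ++ y ++ y ++ z ++ v
  u++v≡ = begin
    u ++ v                    ≡⟨ cong (_++ v) eq ⟩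
    (x ++ y ++ y ++ z) ++ v   ≡⟨ ++-assoc x _ v ⟩
    x ++ (y ++ y ++ z) ++ v   ≡⟨ cong (x ++_) (++-assoc y _ v) ⟩
    x ++ y ++ (y ++ z) ++ v   ≡⟨ cong (λ t → x ++ y ++ t) (++-assoc y z v) ⟩
    x ++ y ++ y ++ z ++ v     ∎

squareFree-++-++⁻ˡ : ∀ u v {w} → SquareFree (u ++ v ++ w) → SquareFree (u ++ v)
squareFree-++-++⁻ˡ u v {w} = squareFree-++⁻ˡ (u ++ v) ∘ subst SquareFree (sym (++-assoc u v w))

map-++-++ : ∀ (f : Letter → Letter) u v w → map f (u ++ v ++ w) ≡ map f u ++ map f v ++ map f w
map-++-++ f u v w = trans (map-++ f u _) (cong (map f u ++_) (map-++ f v w))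

squareFree-map⁻ : ∀ (f : Letter → Letter) {w} → SquareFree (map f w) → SquareFree w
squareFree-map⁻ f sf (x , y , z , y≢[] , refl) =
  sf (map f x , map f y , map f z , map≢[] y≢[] ,
      trans (map-++ f x _) (cong (map f x ++_) (map-++-++ f y y z)))
  where
  map≢[] : ∀ {y} → y ≢ [] → map f y ≢ []
  map≢[] {[]}    y≢[] = ⊥-elim (y≢[] refl)
  map≢[] {_ ∷ _} _    = λ ()

squareFree-[] : SquareFree []
squareFree-[] ([]    , []    , _ , y≢[] , _) = y≢[] refl
squareFree-[] ([]    , _ ∷ _ , _ , _    , ())
squareFree-[] (_ ∷ _ , _     , _ , _    , ())

Triple : Set
Triple = Letter × Letter × Letter

NoRepeat : Triple → Set
NoRepeat (i , j , k) = i ≢ j × j ≢ k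

noRepeat? : ∀ t → Dec (NoRepeat t)
noRepeat? (i , j , k) = ¬? (i ≟ j) ×-dec ¬? (j ≟ k)

noRepeat⇒squareFree : ∀ {i j k} → NoRepeat (i , j , k) → SquareFree (i ∷ j ∷ k ∷ [])
noRepeat⇒squareFree (i≢j , j≢k) =
  squareFree-∷⁺ (squareFree-∷⁺ (squareFree-∷⁺ squareFree-[] ¬sq₁) (¬sq₂ j≢k)) (¬sq₃ i≢j)
  where
  ¬sq₁ : ∀ {k} → ¬ SquarePrefix [ k ]
  ¬sq₁ ([]        , _ , y≢[] , _) = y≢[] refl
  ¬sq₁ (_ ∷ []    , _ , _    , ())
  ¬sq₁ (_ ∷ _ ∷ _ , _ , _    , ())
  ¬sq₂ : ∀ {j k} → j ≢ k → ¬ SquarePrefix (j ∷ k ∷ [])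
  ¬sq₂ j≢k ([]            , _ , y≢[] , _)    = y≢[] refl
  ¬sq₂ j≢k (_ ∷ []        , _ , _    , refl) = j≢k refl
  ¬sq₂ j≢k (_ ∷ _ ∷ []    , _ , _    , ())
  ¬sq₂ j≢k (_ ∷ _ ∷ _ ∷ _ , _ , _    , ())
  ¬sq₃ : ∀ {i j k} → i ≢ j → ¬ SquarePrefix (i ∷ j ∷ k ∷ [])
  ¬sq₃ i≢j ([]                , _ , y≢[] , _)    = y≢[] refl
  ¬sq₃ i≢j (_ ∷ []            , _ , _    , refl) = i≢j refl
  ¬sq₃ i≢j (_ ∷ _ ∷ []        , _ , _    , ())
  ¬sq₃ i≢j (_ ∷ _ ∷ _ ∷ []    , _ , _    , ())
  ¬sq₃ i≢j (_ ∷ _ ∷ _ ∷ _ ∷ _ , _ , _    , ())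

ProductsSquareFree : Word → Word → Word → Word → Set
ProductsSquareFree a b c d =
  ∀ (i i′ i″ : Letter) → SquareFree (i ∷ i′ ∷ i″ ∷ []) →
  ∀ w w′ w″ → w ∈ blocks a b c d i → w′ ∈ blocks a b c d i′ →
  w″ ∈ blocks a b c d i″ → SquareFree (w ++ w′ ++ w″)

product-squareFree : ∀ {a b c d} → ProductsSquareFree a b c d →
  ∀ i i′ i″ → NoRepeat (i , i′ , i″) → ∀ {w w′ w″} → w ∈ blocks a b c d i → w′ ∈ blocks a b c d i′ →
  w″ ∈ blocks a b c d i″ → SquareFree (w ++ w′ ++ w″)
product-squareFree psf i i′ i″ noRepeat = psf i i′ i″ (noRepeat⇒squareFree noRepeat) _ _ _

blocks-⊆ : ∀ {a b a′ b′ c d} → a′ ∈ a ∷ b ∷ [] → b′ ∈ a ∷ b ∷ [] →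
           ∀ i → blocks a′ b′ c d i ⊆ blocks a b c d i
blocks-⊆ a′∈ b′∈ 0F (here refl)         = a′∈
blocks-⊆ a′∈ b′∈ 0F (there (here refl)) = b′∈
blocks-⊆ a′∈ b′∈ 1F w∈                  = w∈
blocks-⊆ a′∈ b′∈ 2F w∈                  = w∈

productsSquareFree-⊆ : ∀ {a b a′ b′ c d} → (∀ i → blocks a′ b′ c d i ⊆ blocks a b c d i) →
                       ProductsSquareFree a b c d → ProductsSquareFree a′ b′ c d
productsSquareFree-⊆ sub psf i i′ i″ sf w w′ w″ w∈ w′∈ w″∈ =
  psf i i′ i″ sf w w′ w″ (sub i w∈) (sub i′ w′∈) (sub i″ w″∈)

rename : Permutation′ 3 → Word → Word
rename π = map (π ⟨$⟩ʳ_)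

rename-inverse : ∀ π w → map (π ⟨$⟩ˡ_) (rename π w) ≡ w
rename-inverse π []      = refl
rename-inverse π (x ∷ w) = cong₂ _∷_ (inverseˡ π) (rename-inverse π w)

rename-injective : ∀ π {u v} → rename π u ≡ rename π v → u ≡ v
rename-injective π {u} {v} eq =
  trans (sym (rename-inverse π u)) (trans (cong (map (π ⟨$⟩ˡ_)) eq) (rename-inverse π v))

squareFree-rename : ∀ π {w} → SquareFree w → SquareFree (rename π w)
squareFree-rename π {w} sf = squareFree-map⁻ (π ⟨$⟩ˡ_) (subst SquareFree (sym (rename-inverse π w)) sf)

blocks-rename : ∀ π a b c d i →
  blocks (rename π a) (rename π b) (rename π c) (rename π d) i ≡ map (rename π) (blocks a b c d i)
blocks-rename π a b c d 0F = refl
blocks-rename π a b c d 1F = refl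
blocks-rename π a b c d 2F = refl

productsSquareFree-rename : ∀ π {a b c d} → ProductsSquareFree a b c d →
  ProductsSquareFree (rename π a) (rename π b) (rename π c) (rename π d)
productsSquareFree-rename π {a} {b} {c} {d} psf i i′ i″ sf w w′ w″ w∈ w′∈ w″∈
  with unrename i w∈ | unrename i′ w′∈ | unrename i″ w″∈
  where
  unrename : ∀ i {w} → w ∈ blocks (rename π a) (rename π b) (rename π c) (rename π d) i →
             ∃[ v ] (v ∈ blocks a b c d i × w ≡ rename π v)
  unrename i w∈ = ∈-map⁻ (rename π) (subst (_ ∈_) (blocks-rename π a b c d i) w∈)
... | v , v∈ , refl | v′ , v′∈ , refl | v″ , v″∈ , refl =
  subst SquareFree (map-++-++ _ v v′ v″) (squareFree-rename π (psf i i′ i″ sf v v′ v″ v∈ v′∈ v″∈))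

brinkhuis211-rename : ∀ π {n a b c d} → Brinkhuis211 n a b c d →
  Brinkhuis211 n (rename π a) (rename π b) (rename π c) (rename π d)
brinkhuis211-rename π {a = a} {b} {c} {d} B = record
  { len-a = trans (length-map _ a) len-a
  ; len-b = trans (length-map _ b) len-b
  ; len-c = trans (length-map _ c) len-c
  ; len-d = trans (length-map _ d) len-d
  ; sf-a = squareFree-rename π sf-a
  ; sf-b = squareFree-rename π sf-b
  ; sf-c = squareFree-rename π sf-c
  ; sf-d = squareFree-rename π sf-d
  ; a≢b = a≢b ∘ rename-injective π
  ; a≢c = a≢c ∘ rename-injective π
  ; a≢d = a≢d ∘ rename-injective π
  ; b≢c = b≢c ∘ rename-injective π
  ; b≢d = b≢d ∘ rename-injective π
  ; c≢d = c≢d ∘ rename-injective π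
  ; concat-sf = productsSquareFree-rename π concat-sf
  }
  where open Brinkhuis211 B

-- Evaluates much faster than `does (x ≟ y)`, which matters for the search below.
_≡ᵇ_ : ∀ {m} → Fin m → Fin m → Bool
zero  ≡ᵇ zero  = true
suc x ≡ᵇ suc y = x ≡ᵇ y
_     ≡ᵇ _     = false

≡ᵇ⇒≡ : ∀ {m} (x y : Fin m) → T (x ≡ᵇ y) → x ≡ y
≡ᵇ⇒≡ zero    zero    _  = refl
≡ᵇ⇒≡ (suc x) (suc y) eq = cong suc (≡ᵇ⇒≡ x y eq)

startsWith01 : Word → Bool
startsWith01 []          = true
startsWith01 (x ∷ [])    = x ≡ᵇ 0F
startsWith01 (x ∷ y ∷ _) = (x ≡ᵇ 0F) ∧ (y ≡ᵇ 1F)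

normaliser : Word → Permutation′ 3
normaliser []          = id
normaliser (x ∷ [])    = transpose 0F x
normaliser (x ∷ y ∷ _) = transpose 0F x ∘ₚ transpose 1F (transpose 0F x ⟨$⟩ʳ y)

normaliser-startsWith01 : ∀ c → SquareFree c → T (startsWith01 (rename (normaliser c) c))
normaliser-startsWith01 []            _  = _
normaliser-startsWith01 (0F ∷ [])     _  = _
normaliser-startsWith01 (1F ∷ [])     _  = _
normaliser-startsWith01 (2F ∷ [])     _  = _
normaliser-startsWith01 (0F ∷ 1F ∷ _) _  = _
normaliser-startsWith01 (0F ∷ 2F ∷ _) _  = _
normaliser-startsWith01 (1F ∷ 0F ∷ _) _  = _
normaliser-startsWith01 (1F ∷ 2F ∷ _) _  = _
normaliser-startsWith01 (2F ∷ 0F ∷ _) _  = _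
normaliser-startsWith01 (2F ∷ 1F ∷ _) _  = _
normaliser-startsWith01 (0F ∷ 0F ∷ _) sf = ⊥-elim (squareFree-∷∷⁻ sf refl)
normaliser-startsWith01 (1F ∷ 1F ∷ _) sf = ⊥-elim (squareFree-∷∷⁻ sf refl)
normaliser-startsWith01 (2F ∷ 2F ∷ _) sf = ⊥-elim (squareFree-∷∷⁻ sf refl)

agree : ℕ → Word → Word → Bool
agree zero    _       _       = true
agree (suc k) (x ∷ u) (y ∷ v) = (x ≡ᵇ y) ∧ agree k u v
agree (suc k) _       _       = false

agree-sound : ∀ y {w u r k} → w ≡ y ++ u → length y ≡ k → T (agree k w r) → ∃[ z ] r ≡ y ++ z
agree-sound []      {r = r}      refl refl _ = r , refl
agree-sound (x ∷ y) {r = []}     refl refl ()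
agree-sound (x ∷ y) {r = x′ ∷ r} refl refl h with Equivalence.to T-∧ h
... | x≡x′ , agrees with ≡ᵇ⇒≡ x x′ x≡x′ | agree-sound y refl refl agrees
... | refl | z , refl = z , refl

-- Invariant: w ≡ y ++ r with length y ≡ l; the candidate half y ++ [ x ] (x the head of r) is tried
-- while s, which loses two letters per step, shows that w is long enough to contain the square.
squareAfter : Word → ℕ → Word → Word → Bool
squareAfter w l (_ ∷ r) (_ ∷ _ ∷ s) = agree (suc l) w r ∨ squareAfter w (suc l) r s
squareAfter w l _       _           = false

squareAfter-sound : ∀ y r {w l s} → w ≡ y ++ r → length y ≡ l → T (squareAfter w l r s) → SquarePrefix w
squareAfter-sound y (x ∷ r) {w} {s = _ ∷ _ ∷ s} w≡ refl h =
  [ squareHalf , squareAfter-sound y′ r w≡′ |y′|≡ ]′ (Equivalence.to T-∨ h)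
  where
  y′ = y ++ [ x ]
  w≡′ = trans w≡ (sym (++-assoc y [ x ] r))
  |y′|≡ = trans (length-++ y) (+-comm (length y) 1)
  squareHalf : T (agree (suc (length y)) w r) → SquarePrefix w
  squareHalf agrees =
    let z , r≡ = agree-sound y′ w≡′ |y′|≡ agrees
    in y′ , z , (λ ()) ∘ ++-conicalʳ y [ x ] , trans w≡′ (cong (y′ ++_) r≡)

hasSquareWithin : ℕ → Word → Bool
hasSquareWithin zero    _       = false
hasSquareWithin (suc k) []      = false
hasSquareWithin (suc k) (x ∷ w) = hasSquareWithin k w ∨ squareAfter (x ∷ w) 0 (x ∷ w) (x ∷ w)

hasSquareWithin-sound : ∀ k w → T (hasSquareWithin k w) → ¬ SquareFree w
hasSquareWithin-sound (suc k) (x ∷ w) h =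
  [ (λ later → hasSquareWithin-sound k w later ∘ squareFree-++⁻ʳ [ x ])
  , squarePrefix⇒¬squareFree ∘ squareAfter-sound [] (x ∷ w) {s = x ∷ w} refl refl
  ]′ (Equivalence.to T-∨ h)

NoSquareWithin : ℕ → Word → Set
NoSquareWithin k w = T (not (hasSquareWithin k w))

noSquareWithin? : ∀ k w → Dec (NoSquareWithin k w)
noSquareWithin? k w = T? (not (hasSquareWithin k w))

squareFree⇒noSquareWithin : ∀ k {w} → SquareFree w → NoSquareWithin k w
squareFree⇒noSquareWithin k {w} sf with hasSquareWithin k w in eq
... | true  = hasSquareWithin-sound k w (subst T (sym eq) _) sf
... | false = _

prependable? : ∀ ts v → Dec (All (λ t → NoSquareWithin 1 (v ++ t)) ts)
prependable? ts v = All.all? (λ t → noSquareWithin? 1 (v ++ t)) ts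

compatiblePrefixes : List Word → ℕ → List Word
compatiblePrefixes ts zero    = [ [] ]
compatiblePrefixes ts (suc n) =
  concatMap (λ w → filter (prependable? ts) (map (_∷ w) (allFin 3))) (compatiblePrefixes ts n)

∈-compatiblePrefixes : ∀ ts {w n} → length w ≡ n → All (λ t → SquareFree (w ++ t)) ts →
                       w ∈ compatiblePrefixes ts n
∈-compatiblePrefixes ts {[]}    refl _   = here refl
∈-compatiblePrefixes ts {x ∷ w} refl sfs = ∈-concatMap⁺ _ (lose w∈ xw∈)
  where
  w∈ = ∈-compatiblePrefixes ts refl (All.map (squareFree-++⁻ʳ [ x ]) sfs)
  xw∈ = ∈-filter⁺ (prependable? ts) (∈-map⁺ (_∷ w) (∈-allFin x)) (All.map (squareFree⇒noSquareWithin 1) sfs)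

allTriples : List Triple
allTriples = cartesianProduct (allFin 3) (cartesianProduct (allFin 3) (allFin 3))

squareFreeTriples : List Triple
squareFreeTriples = filter noRepeat? allTriples

ProductsPass : ℕ → (Letter → List Word) → Set
ProductsPass k B = All (λ (i , i′ , i″) →
  All (λ w → All (λ w′ → All (λ w″ → NoSquareWithin k (w ++ w′ ++ w″)) (B i″)) (B i′)) (B i))
  squareFreeTriples

productsPass? : ∀ k B → Dec (ProductsPass k B)
productsPass? k B = All.all? (λ (i , i′ , i″) →
  All.all? (λ w → All.all? (λ w′ → All.all? (λ w″ → noSquareWithin? k (w ++ w′ ++ w″)) (B i″)) (B i′)) (B i))
  squareFreeTriples

productsPass-complete : ∀ k {a b c d} → ProductsSquareFree a b c d → ProductsPass k (blocks a b c d)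
productsPass-complete k psf = All.tabulate λ t∈ →
  let noRepeat = proj₂ (∈-filter⁻ noRepeat? {xs = allTriples} t∈) in
  All.tabulate λ w∈ → All.tabulate λ w′∈ → All.tabulate λ w″∈ →
  squareFree⇒noSquareWithin k (product-squareFree psf _ _ _ noRepeat w∈ w′∈ w″∈)

_≟ʷ_ : (u v : Word) → Dec (u ≡ v)
_≟ʷ_ = ≡-dec _≟_

-- In a product of square-free blocks of length n, a square must start before the last block;
-- hence the bounds n and n + n below.
dCandidate? : ∀ n c d → Dec (c ≢ d × NoSquareWithin n (c ++ d) ×
                             NoSquareWithin (n + n) (d ++ c ++ d) × NoSquareWithin (n + n) (c ++ d ++ c))
dCandidate? n c d = ¬? (c ≟ʷ d) ×-dec noSquareWithin? n (c ++ d) ×-dec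
  noSquareWithin? (n + n) (d ++ c ++ d) ×-dec noSquareWithin? (n + n) (c ++ d ++ c)

aCandidate? : ∀ n c d a → Dec (NoSquareWithin n (c ++ a) × NoSquareWithin n (d ++ a) ×
                               ProductsPass (n + n) (blocks a a c d))
aCandidate? n c d a = noSquareWithin? n (c ++ a) ×-dec noSquareWithin? n (d ++ a) ×-dec
  productsPass? (n + n) (blocks a a c d)

partner? : ∀ n c d a b → Dec (a ≢ b × ProductsPass (n + n) (blocks a b c d))
partner? n c d a b = ¬? (a ≟ʷ b) ×-dec productsPass? (n + n) (blocks a b c d)

cCandidates : ℕ → List Word
cCandidates n = filter (T? ∘ startsWith01) (compatiblePrefixes [ [] ] n)

dCandidates : ℕ → Word → List Word
dCandidates n c = filter (dCandidate? n c) (compatiblePrefixes [ c ] n)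

aCandidates : ℕ → Word → Word → List Word
aCandidates n c d = filter (aCandidate? n c d) (compatiblePrefixes (c ∷ d ∷ []) n)

abPairs : ℕ → Word → Word → List Word → List (Word × Word × Word × Word)
abPairs n c d as = concatMap (λ a → map (λ b → a , b , c , d) (filter (partner? n c d a) as)) as

candidates : ℕ → List (Word × Word × Word × Word)
candidates n =
  concatMap (λ c → concatMap (λ d → abPairs n c d (aCandidates n c d)) (dCandidates n c)) (cCandidates n)

module _ {n a b c d} (B : Brinkhuis211 n a b c d) where
  open Brinkhuis211 B

  private
    product : ∀ i i′ i″ → NoRepeat (i , i′ , i″) → ∀ {w w′ w″} → w ∈ blocks a b c d i →
              w′ ∈ blocks a b c d i′ → w″ ∈ blocks a b c d i″ → SquareFree (w ++ w′ ++ w″)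
    product = product-squareFree concat-sf

    c∈ : c ∈ blocks a b c d 1F
    c∈ = here refl

    d∈ : d ∈ blocks a b c d 2F
    d∈ = here refl

    cdc : SquareFree (c ++ d ++ c)
    cdc = product 1F 2F 1F ((λ ()) , (λ ())) c∈ d∈ c∈

    dcd : SquareFree (d ++ c ++ d)
    dcd = product 2F 1F 2F ((λ ()) , (λ ())) d∈ c∈ d∈

  ∈-cCandidates : T (startsWith01 c) → c ∈ cCandidates n
  ∈-cCandidates c01 = ∈-filter⁺ (T? ∘ startsWith01)
    (∈-compatiblePrefixes [ [] ] len-c (subst SquareFree (sym (++-identityʳ c)) sf-c ∷ [])) c01

  ∈-dCandidates : d ∈ dCandidates n c
  ∈-dCandidates = ∈-filter⁺ (dCandidate? n c)
    (∈-compatiblePrefixes [ c ] len-d (squareFree-++-++⁻ˡ d c dcd ∷ []))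
    ( c≢d
    , squareFree⇒noSquareWithin n (squareFree-++-++⁻ˡ c d cdc)
    , squareFree⇒noSquareWithin (n + n) dcd
    , squareFree⇒noSquareWithin (n + n) cdc )

  ∈-aCandidates : ∀ {x} → x ∈ a ∷ b ∷ [] → length x ≡ n → x ∈ aCandidates n c d
  ∈-aCandidates {x} x∈ |x|≡n = ∈-filter⁺ (aCandidate? n c d)
    (∈-compatiblePrefixes (c ∷ d ∷ []) |x|≡n
      ( squareFree-++-++⁻ˡ x c (product 0F 1F 0F ((λ ()) , (λ ())) x∈ c∈ x∈)
      ∷ squareFree-++-++⁻ˡ x d (product 0F 2F 0F ((λ ()) , (λ ())) x∈ d∈ x∈) ∷ []))
    ( squareFree⇒noSquareWithin n (squareFree-++-++⁻ˡ c x (product 1F 0F 1F ((λ ()) , (λ ())) c∈ x∈ c∈))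
    , squareFree⇒noSquareWithin n (squareFree-++-++⁻ˡ d x (product 2F 0F 2F ((λ ()) , (λ ())) d∈ x∈ d∈))
    , productsPass-complete (n + n) (productsSquareFree-⊆ (blocks-⊆ x∈ x∈) concat-sf) )

  ∈-candidates : T (startsWith01 c) → (a , b , c , d) ∈ candidates n
  ∈-candidates c01 =
    ∈-concatMap⁺ _ (lose (∈-cCandidates c01) (∈-concatMap⁺ _ (lose ∈-dCandidates (∈-concatMap⁺ _
      (lose (∈-aCandidates (here refl) len-a) (∈-map⁺ _ (∈-filter⁺ (partner? n c d a)
        (∈-aCandidates (there (here refl)) len-b) (a≢b , productsPass-complete (n + n) concat-sf))))))))

candidates-empty : ∀ {n} → n < 18 → candidates n ≡ []
candidates-empty = applyUpTo⁻ {P = λ n → candidates n ≡ []} (λ n → n) 18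
  ( refl ∷ refl ∷ refl ∷ refl ∷ refl ∷ refl ∷ refl ∷ refl ∷ refl
  ∷ refl ∷ refl ∷ refl ∷ refl ∷ refl ∷ refl ∷ refl ∷ refl ∷ refl ∷ [] )

∉-candidates : ∀ {n q} → n < 18 → ¬ q ∈ candidates n
∉-candidates n<18 = ¬Any[] ∘ subst (_ ∈_) (candidates-empty n<18)

lemma4 : ∀ (n : ℕ) → 1 ≤ n → ∀ (a b c d : Word) → Brinkhuis211 n a b c d → n > 17
lemma4 n _ a b c d B with 17 <? n
... | yes n>17 = n>17
... | no n≯17  = ⊥-elim (∉-candidates (s≤s (≮⇒≥ n≯17)) found)
  where
  π : Permutation′ 3
  π = normaliser c
  found : (rename π a , rename π b , rename π c , rename π d) ∈ candidates n
  found = ∈-candidates (brinkhuis211-rename π B) (normaliser-startsWith01 c (Brinkhuis211.sf-c B))
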